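{- Let $F:\mathbb{N}\to\mathbb{N}$ be a fixed total recursive function. The set $$SI(F)=\{x\in\mathbb{N}\mid \forall z,\ \varphi_x(z)\downarrow\implies \varphi_x(z)\leq F(z)\}$$ (the sup-interpretation verification problem for $F$) is $\Pi^0_1$-complete in the arithmetical hierarchy.
   Context: Fix an acceptable Gödel numbering of the partial recursive functions: $\varphi_x$ denotes the partial recursive function $\mathbb{N}\to\mathbb{N}$ with Gödel number $x$; $\varphi_x(z)\downarrow$ means $\varphi_x$ is defined on $z$. A sup-interpretation of a partial recursive function $f$ is a total recursive function $F$ with $F(z)\geq f(z)$ whenever $f(z)$ is defined; thus $x\in SI(F)$ says that $F$ is a sup-interpretation of $\varphi_x$. -}

module Defs where

open import Data.Nat using (ℕ; zero; suc; _≤_; _<_)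
open import Data.List using (List; []; _∷_)
open import Data.Product using (Σ; _×_; _,_; ∃)

-- Codes of (untyped) μ-recursive functions.  Arguments are passed as lists;
-- a missing argument is read as 0.
data Code : Set where
  Z : Code
  S : Code
  P : ℕ → Code
  C : Code → List Code → Code
  R : Code → Code → Code
  M : Code → Code

arg : ℕ → List ℕ → ℕ
arg _       []       = 0
arg zero    (x ∷ _)  = x
arg (suc i) (_ ∷ xs) = arg i xs

mutual
  data _[_]⇓_ : Code → List ℕ → ℕ → Set where
    ⇓Z : ∀ {xs} → Z [ xs ]⇓ 0
    ⇓S : ∀ {xs} → S [ xs ]⇓ suc (arg 0 xs)
    ⇓P : ∀ {i xs} → P i [ xs ]⇓ arg i xs
    ⇓C : ∀ {f gs xs ys v} → gs [ xs ]⇓* ys → f [ ys ]⇓ v → C f gs [ xs ]⇓ v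
    ⇓R0 : ∀ {f g xs v} → f [ xs ]⇓ v → R f g [ 0 ∷ xs ]⇓ v
    ⇓Rs : ∀ {f g n xs u v} → R f g [ n ∷ xs ]⇓ u → g [ n ∷ u ∷ xs ]⇓ v →
          R f g [ suc n ∷ xs ]⇓ v
    ⇓M : ∀ {f xs n} → f [ n ∷ xs ]⇓ 0 →
         (∀ m → m < n → Σ ℕ λ k → f [ m ∷ xs ]⇓ suc k) → M f [ xs ]⇓ n

  data _[_]⇓*_ : List Code → List ℕ → List ℕ → Set where
    []⇓  : ∀ {xs} → [] [ xs ]⇓* []
    ∷⇓ : ∀ {g gs xs y ys} → g [ xs ]⇓ y → gs [ xs ]⇓* ys → (g ∷ gs) [ xs ]⇓* (y ∷ ys)

-- Cantor-style enumeration of ℕ × ℕ (a bijection ℕ → ℕ × ℕ), by diagonals.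
unpair : ℕ → ℕ × ℕ
unpair zero = 0 , 0
unpair (suc n) with unpair n
... | zero  , b = suc b , 0
... | suc a , b = a , suc b

-- Decoding of natural numbers into codes (fuel-bounded; the fuel x suffices
-- for every code, so decode is surjective).
mutual
  decode′ : ℕ → ℕ → Code
  decode′ zero    _ = Z
  decode′ (suc k) n with unpair n
  ... | 0 , _ = Z
  ... | 1 , _ = S
  ... | 2 , i = P i
  ... | 3 , r with unpair r
  ...   | a , b = C (decode′ k a) (decodeList k b)
  decode′ (suc k) n | 4 , r with unpair r
  ...   | a , b = R (decode′ k a) (decode′ k b)
  decode′ (suc k) n | 5 , r = M (decode′ k r)
  decode′ (suc k) n | _ , _ = Z

  decodeList : ℕ → ℕ → List Code
  decodeList zero    _       = []
  decodeList (suc k) zero    = []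
  decodeList (suc k) (suc m) with unpair m
  ... | a , b = decode′ k a ∷ decodeList k b

decode : ℕ → Code
decode x = decode′ x x

φ_[_]⇓_ : ℕ → ℕ → ℕ → Set
φ x [ z ]⇓ v = decode x [ z ∷ [] ]⇓ v

TotalRecursive : (ℕ → ℕ) → Set
TotalRecursive F = Σ ℕ λ e → ∀ z → φ e [ z ]⇓ F z

SI : (ℕ → ℕ) → ℕ → Set
SI F x = ∀ z v → φ x [ z ]⇓ v → v ≤ F z

Π⁰₁ : (ℕ → Set) → Set
Π⁰₁ A = Σ Code λ c →
          (∀ x n → Σ ℕ λ b → c [ x ∷ n ∷ [] ]⇓ b) ×
          (∀ x → (A x → ∀ n → c [ x ∷ n ∷ [] ]⇓ 0) ×
                 ((∀ n → c [ x ∷ n ∷ [] ]⇓ 0) → A x))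

_≤ₘ_ : (ℕ → Set) → (ℕ → Set) → Set
B ≤ₘ A = Σ ℕ λ e → (∀ x → Σ ℕ λ y → φ e [ x ]⇓ y) ×
                   (∀ x y → φ e [ x ]⇓ y → (B x → A y) × (A y → B x))

Π⁰₁-complete : (ℕ → Set) → Set₁
Π⁰₁-complete A = Π⁰₁ A × ((B : ℕ → Set) → Π⁰₁ B → B ≤ₘ A)

-- SI(F) is Π⁰₁: x ∉ SI(F) iff for some (z , t) the run of φ_x on z halts within t steps with a
-- value above F z.  Clocked runs are primitive recursive: the big-step semantics of codes is
-- simulated by a small-step abstract machine, and on states coded by Cantor pairing its
-- transition function is built from primitive recursive terms compiled to codes.
--
-- SI(F) is Π⁰₁-hard: if x ∈ B ⇔ ∀ n. c (x , n) = 0 with c total, send x to an index of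
-- z ↦ (μ n. c (x , n) ≠ 0) ; F z + 1.  For x ∈ B this function is nowhere defined, so it lies
-- in SI(F); otherwise it is total and exceeds F everywhere.

module Submission where

open import Defs
open import Data.Nat using (ℕ; zero; suc; pred; _+_; _∸_; ∣_-_∣; _≤_; _<_; z≤n; s≤s)
open import Data.Nat.Properties
open import Data.Nat.GeneralisedArithmetic using (fold; iterate; iterate-is-fold)
open import Data.List using (List; []; _∷_; _++_; _ʳ++_; length)
open import Data.List.Properties using (++-assoc; length-++)
open import Data.Vec using (Vec; []; _∷_; toList; lookup)
open import Data.Fin using (Fin; toℕ) renaming (zero to #0; suc to 1+)
open import Data.Product using (Σ; _×_; _,_; proj₁; proj₂)
open import Data.Sum using (_⊎_; inj₁; inj₂; [_,_]′)
open import Data.Empty using (⊥; ⊥-elim)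
open import Relation.Binary using (tri<; tri≈; tri>)
open import Relation.Nullary using (¬_)
open import Relation.Binary.PropositionalEquality

mutual
  ⇓-deterministic : ∀ {c xs v w} → c [ xs ]⇓ v → c [ xs ]⇓ w → v ≡ w
  ⇓-deterministic ⇓Z ⇓Z = refl
  ⇓-deterministic ⇓S ⇓S = refl
  ⇓-deterministic ⇓P ⇓P = refl
  ⇓-deterministic (⇓C gs f) (⇓C gs′ f′) with ⇓*-deterministic gs gs′
  ... | refl = ⇓-deterministic f f′
  ⇓-deterministic (⇓R0 f) (⇓R0 f′) = ⇓-deterministic f f′
  ⇓-deterministic (⇓Rs r g) (⇓Rs r′ g′) with ⇓-deterministic r r′
  ... | refl = ⇓-deterministic g g′
  ⇓-deterministic (⇓M {n = n} f below) (⇓M {n = n′} f′ below′) with <-cmp n n′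
  ... | tri≈ _ n≡n′ _ = n≡n′
  ... | tri< n<n′ _ _ = ⊥-elim (⇓0-⇓suc-disjoint f (proj₂ (below′ n n<n′)))
  ... | tri> _ _ n′<n = ⊥-elim (⇓0-⇓suc-disjoint f′ (proj₂ (below n′ n′<n)))

  ⇓0-⇓suc-disjoint : ∀ {c xs k} → c [ xs ]⇓ 0 → ¬ c [ xs ]⇓ suc k
  ⇓0-⇓suc-disjoint d d′ with ⇓-deterministic d d′
  ... | ()

  ⇓*-deterministic : ∀ {gs xs ys zs} → gs [ xs ]⇓* ys → gs [ xs ]⇓* zs → ys ≡ zs
  ⇓*-deterministic []⇓ []⇓ = refl
  ⇓*-deterministic (∷⇓ g gs) (∷⇓ g′ gs′) = cong₂ _∷_ (⇓-deterministic g g′) (⇓*-deterministic gs gs′)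

-- Primitive recursive terms compiled to codes

record Computable (k : ℕ) : Set where
  field
    code    : Code
    fun     : Vec ℕ k → ℕ
    correct : ∀ ρ → code [ toList ρ ]⇓ fun ρ

data Term (N : ℕ) : Set where
  var  : Fin N → Term N
  zero : Term N
  suc  : Term N → Term N
  rec  : Term N → Term N → Term (2 + N) → Term N
  call : ∀ {k} → Computable k → Vec (Term N) k → Term N

open Computable

mutual
  ⟦_⟧ : ∀ {N} → Term N → Vec ℕ N → ℕ
  ⟦ var i ⟧ ρ = lookup ρ i
  ⟦ zero ⟧ ρ = 0
  ⟦ suc t ⟧ ρ = suc (⟦ t ⟧ ρ)
  ⟦ rec n b s ⟧ ρ = recursion s ρ (⟦ b ⟧ ρ) (⟦ n ⟧ ρ)
  ⟦ call f ts ⟧ ρ = fun f (⟦ ts ⟧* ρ)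

  ⟦_⟧* : ∀ {N k} → Vec (Term N) k → Vec ℕ N → Vec ℕ k
  ⟦ [] ⟧* ρ = []
  ⟦ t ∷ ts ⟧* ρ = ⟦ t ⟧ ρ ∷ ⟦ ts ⟧* ρ

  recursion : ∀ {N} → Term (2 + N) → Vec ℕ N → ℕ → ℕ → ℕ
  recursion s ρ u zero = u
  recursion s ρ u (suc m) = ⟦ s ⟧ (m ∷ recursion s ρ u m ∷ ρ)

projections : ℕ → ℕ → List Code
projections i zero = []
projections i (suc n) = P i ∷ projections (suc i) n

mutual
  compile : ∀ {N} → Term N → Code
  compile (var i) = P (toℕ i)
  compile zero = Z
  compile (suc t) = C S (compile t ∷ [])
  compile {N} (rec n b s) = C (R (compile b) (compile s)) (compile n ∷ projections 0 N)
  compile (call f ts) = C (code f) (compile* ts)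

  compile* : ∀ {N k} → Vec (Term N) k → List Code
  compile* [] = []
  compile* (t ∷ ts) = compile t ∷ compile* ts

arg-toℕ : ∀ {N} (ρ : Vec ℕ N) i → arg (toℕ i) (toList ρ) ≡ lookup ρ i
arg-toℕ (x ∷ ρ) #0 = refl
arg-toℕ (x ∷ ρ) (1+ i) = arg-toℕ ρ i

arg-length : ∀ (xs : List ℕ) x ys → arg (length xs) (xs ++ x ∷ ys) ≡ x
arg-length [] x ys = refl
arg-length (_ ∷ xs) x ys = arg-length xs x ys

projections-correct : ∀ {N} (xs : List ℕ) (ρ : Vec ℕ N) →
                      projections (length xs) N [ xs ++ toList ρ ]⇓* toList ρ
projections-correct xs [] = []⇓
projections-correct xs (x ∷ ρ) =
  ∷⇓ (subst (P (length xs) [ xs ++ x ∷ toList ρ ]⇓_) (arg-length xs x (toList ρ)) ⇓P) rest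
  where
  rest : projections (suc (length xs)) _ [ xs ++ x ∷ toList ρ ]⇓* toList ρ
  rest = subst₂ (λ i ys → projections i _ [ ys ]⇓* toList ρ)
                (trans (length-++ xs) (+-comm (length xs) 1)) (++-assoc xs (x ∷ []) (toList ρ))
                (projections-correct (xs ++ x ∷ []) ρ)

mutual
  compile-correct : ∀ {N} (t : Term N) ρ → compile t [ toList ρ ]⇓ ⟦ t ⟧ ρ
  compile-correct (var i) ρ = subst (P (toℕ i) [ toList ρ ]⇓_) (arg-toℕ ρ i) ⇓P
  compile-correct zero ρ = ⇓Z
  compile-correct (suc t) ρ = ⇓C (∷⇓ (compile-correct t ρ) []⇓) ⇓S
  compile-correct (rec n b s) ρ =
    ⇓C (∷⇓ (compile-correct n ρ) (projections-correct [] ρ)) (recursion-correct b s ρ (⟦ n ⟧ ρ))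
  compile-correct (call f ts) ρ = ⇓C (compile*-correct ts ρ) (correct f (⟦ ts ⟧* ρ))

  compile*-correct : ∀ {N k} (ts : Vec (Term N) k) ρ → compile* ts [ toList ρ ]⇓* toList (⟦ ts ⟧* ρ)
  compile*-correct [] ρ = []⇓
  compile*-correct (t ∷ ts) ρ = ∷⇓ (compile-correct t ρ) (compile*-correct ts ρ)

  recursion-correct : ∀ {N} (b : Term N) s ρ m →
                      R (compile b) (compile s) [ m ∷ toList ρ ]⇓ recursion s ρ (⟦ b ⟧ ρ) m
  recursion-correct b s ρ zero = ⇓R0 (compile-correct b ρ)
  recursion-correct b s ρ (suc m) =
    ⇓Rs (recursion-correct b s ρ m) (compile-correct s (m ∷ recursion s ρ (⟦ b ⟧ ρ) m ∷ ρ))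

computable : ∀ {k} (t : Term k) (f : Vec ℕ k → ℕ) → (∀ ρ → ⟦ t ⟧ ρ ≡ f ρ) → Computable k
computable t f ⟦t⟧≡f = record
  { code = compile t ; fun = f ; correct = λ ρ → subst (compile t [ toList ρ ]⇓_) (⟦t⟧≡f ρ) (compile-correct t ρ) }

module _ {N : ℕ} where
  infixl 9 _⟨_⟩ _⟨_∣_⟩ _⟨_∣_∣_⟩ _⟨_∣_∣_∣_⟩ _⟨_∣_∣_∣_∣_⟩ _⟨_∣_∣_∣_∣_∣_⟩ _⟨_∣_∣_∣_∣_∣_∣_⟩

  _⟨_⟩ : Computable 1 → Term N → Term N
  f ⟨ a ⟩ = call f (a ∷ [])

  _⟨_∣_⟩ : Computable 2 → Term N → Term N → Term N
  f ⟨ a ∣ b ⟩ = call f (a ∷ b ∷ [])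

  _⟨_∣_∣_⟩ : Computable 3 → Term N → Term N → Term N → Term N
  f ⟨ a ∣ b ∣ c ⟩ = call f (a ∷ b ∷ c ∷ [])

  _⟨_∣_∣_∣_⟩ : Computable 4 → Term N → Term N → Term N → Term N → Term N
  f ⟨ a ∣ b ∣ c ∣ d ⟩ = call f (a ∷ b ∷ c ∷ d ∷ [])

  _⟨_∣_∣_∣_∣_⟩ : Computable 5 → Term N → Term N → Term N → Term N → Term N → Term N
  f ⟨ a ∣ b ∣ c ∣ d ∣ e ⟩ = call f (a ∷ b ∷ c ∷ d ∷ e ∷ [])

  _⟨_∣_∣_∣_∣_∣_⟩ : Computable 6 → Term N → Term N → Term N → Term N → Term N → Term N → Term N
  f ⟨ a ∣ b ∣ c ∣ d ∣ e ∣ g ⟩ = call f (a ∷ b ∷ c ∷ d ∷ e ∷ g ∷ [])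

  _⟨_∣_∣_∣_∣_∣_∣_⟩ : Computable 7 → Term N → Term N → Term N → Term N → Term N → Term N → Term N → Term N
  f ⟨ a ∣ b ∣ c ∣ d ∣ e ∣ g ∣ h ⟩ = call f (a ∷ b ∷ c ∷ d ∷ e ∷ g ∷ h ∷ [])

v0 : ∀ {N} → Term (1 + N)
v0 = var #0
v1 : ∀ {N} → Term (2 + N)
v1 = var (1+ #0)
v2 : ∀ {N} → Term (3 + N)
v2 = var (1+ (1+ #0))
v3 : ∀ {N} → Term (4 + N)
v3 = var (1+ (1+ (1+ #0)))
v4 : ∀ {N} → Term (5 + N)
v4 = var (1+ (1+ (1+ (1+ #0))))
v5 : ∀ {N} → Term (6 + N)
v5 = var (1+ (1+ (1+ (1+ (1+ #0)))))
v6 : ∀ {N} → Term (7 + N)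
v6 = var (1+ (1+ (1+ (1+ (1+ (1+ #0))))))

recursion-fold : ∀ {N} (f : Computable 1) (ρ : Vec ℕ N) u m →
                 recursion (f ⟨ v1 ⟩) ρ u m ≡ fold u (λ x → fun f (x ∷ [])) m
recursion-fold f ρ u zero = refl
recursion-fold f ρ u (suc m) = cong (λ x → fun f (x ∷ [])) (recursion-fold f ρ u m)

recursion-iterate : ∀ {N} (f : Computable 1) (ρ : Vec ℕ N) u m →
                    recursion (f ⟨ v1 ⟩) ρ u m ≡ iterate (λ x → fun f (x ∷ [])) u m
recursion-iterate f ρ u m = trans (recursion-fold f ρ u m) (iterate-is-fold u _ m)

ifz : {A : Set} → ℕ → A → A → A
ifz zero x y = x
ifz (suc _) x y = y

predᶜ : Computable 1
predᶜ = computable (rec v0 zero v0) (λ { (a ∷ []) → pred a }) λ { (zero ∷ []) → refl ; (suc a ∷ []) → refl }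

+ᶜ : Computable 2
+ᶜ = computable (rec v0 v1 (suc v1)) (λ { (a ∷ b ∷ []) → a + b }) λ { (a ∷ b ∷ []) → sum a b }
  where
  sum : ∀ {ρ} a b → recursion (suc v1) ρ b a ≡ a + b
  sum zero b = refl
  sum (suc a) b = cong suc (sum a b)

∸ᶜ : Computable 2
∸ᶜ = computable (rec v1 v0 (predᶜ ⟨ v1 ⟩)) (λ { (a ∷ b ∷ []) → a ∸ b }) λ { (a ∷ b ∷ []) → monus a b }
  where
  monus : ∀ {ρ} a b → recursion (predᶜ ⟨ v1 ⟩) ρ a b ≡ a ∸ b
  monus a zero = refl
  monus a (suc b) = trans (cong pred (monus a b)) (pred[m∸n]≡m∸[1+n] a b)

∣-∣ᶜ : Computable 2
∣-∣ᶜ = computable (+ᶜ ⟨ ∸ᶜ ⟨ v0 ∣ v1 ⟩ ∣ ∸ᶜ ⟨ v1 ∣ v0 ⟩ ⟩) (λ { (a ∷ b ∷ []) → ∣ a - b ∣ })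
                   λ { (a ∷ b ∷ []) → sym (∣-∣≡∸+∸ a b) }
  where
  ∣-∣≡∸+∸ : ∀ a b → ∣ a - b ∣ ≡ (a ∸ b) + (b ∸ a)
  ∣-∣≡∸+∸ zero zero = refl
  ∣-∣≡∸+∸ zero (suc b) = refl
  ∣-∣≡∸+∸ (suc a) zero = sym (+-identityʳ (suc a))
  ∣-∣≡∸+∸ (suc a) (suc b) = ∣-∣≡∸+∸ a b

ifzᶜ : Computable 3
ifzᶜ = computable (rec v0 v1 v4) (λ { (c ∷ x ∷ y ∷ []) → ifz c x y })
  λ { (zero ∷ x ∷ y ∷ []) → refl ; (suc c ∷ x ∷ y ∷ []) → refl }

constant : ℕ → Code
constant zero = Z
constant (suc n) = C S (constant n ∷ [])

constant-correct : ∀ n xs → constant n [ xs ]⇓ n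
constant-correct zero xs = ⇓Z
constant-correct (suc n) xs = ⇓C (∷⇓ (constant-correct n xs) []⇓) ⇓S

constᶜ : ℕ → Computable 0
constᶜ n = record { code = constant n ; fun = λ _ → n ; correct = λ ρ → constant-correct n (toList ρ) }

lit : ∀ {N} → ℕ → Term N
lit n = call (constᶜ n) []

-- Cantor pairing

triangle : ℕ → ℕ
triangle zero = 0
triangle (suc d) = triangle d + suc d

triangleᶜ : Computable 1
triangleᶜ = computable (rec v0 zero (+ᶜ ⟨ v1 ∣ suc v0 ⟩)) (λ { (d ∷ []) → triangle d }) λ { (d ∷ []) → triangles d }
  where
  triangles : ∀ {ρ} d → recursion (+ᶜ ⟨ v1 ∣ suc v0 ⟩) ρ 0 d ≡ triangle d
  triangles zero = refl
  triangles (suc d) = cong (_+ suc d) (triangles d)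

-- Opaque: unfolding pair inside the coded machine states below makes type checking very slow.
opaque
  pair : ℕ → ℕ → ℕ
  pair a b = triangle (a + b) + b

  pair-definition : ∀ a b → pair a b ≡ triangle (a + b) + b
  pair-definition a b = refl

pairᶜ : Computable 2
pairᶜ = computable (+ᶜ ⟨ triangleᶜ ⟨ +ᶜ ⟨ v0 ∣ v1 ⟩ ⟩ ∣ v1 ⟩) (λ { (a ∷ b ∷ []) → pair a b })
                   λ { (a ∷ b ∷ []) → sym (pair-definition a b) }

χ≤ : ℕ → ℕ → ℕ
χ≤ x y = 1 ∸ (x ∸ y)

-- The index d of the diagonal a + b = d containing unpair m.
diagonal : ℕ → ℕ
diagonal zero = 0
diagonal (suc m) = χ≤ (triangle (suc (diagonal m))) (suc m) + diagonal m

diagonalᶜ : Computable 1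
diagonalᶜ = computable (rec v0 zero next) (λ { (m ∷ []) → diagonal m }) λ { (m ∷ []) → diagonals m }
  where
  next : Term 3
  next = +ᶜ ⟨ ∸ᶜ ⟨ lit 1 ∣ ∸ᶜ ⟨ triangleᶜ ⟨ suc v1 ⟩ ∣ suc v0 ⟩ ⟩ ∣ v1 ⟩
  diagonals : ∀ {ρ} m → recursion next ρ 0 m ≡ diagonal m
  diagonals zero = refl
  diagonals (suc m) = cong (λ d → χ≤ (triangle (suc d)) (suc m) + d) (diagonals m)

χ≤-yes : ∀ {x y} → x ≤ y → χ≤ x y ≡ 1
χ≤-yes x≤y = cong (1 ∸_) (m≤n⇒m∸n≡0 x≤y)

χ≤-no : ∀ {x y} → y < x → χ≤ x y ≡ 0
χ≤-no y<x = m≤n⇒m∸n≡0 (m<n⇒0<n∸m y<x)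

unpair-diagonal : ∀ m → Σ ℕ λ b → b ≤ diagonal m × m ≡ triangle (diagonal m) + b × unpair m ≡ (diagonal m ∸ b , b)
unpair-diagonal zero = 0 , z≤n , refl , refl
unpair-diagonal (suc m) with unpair-diagonal m
... | b , b≤d , m≡ , unpair-m with m≤n⇒m<n∨m≡n b≤d
... | inj₂ refl = 0 , z≤n , trans 1+m≡ (sym (cong (λ d → triangle d + 0) next-diagonal)) , unpair-1+m
  where
  1+m≡ : suc m ≡ triangle (suc b) + 0
  1+m≡ = trans (cong suc m≡) (trans (sym (+-suc (triangle b) b)) (sym (+-identityʳ _)))
  next-diagonal : diagonal (suc m) ≡ suc b
  next-diagonal = cong (_+ b) (χ≤-yes (≤-reflexive (trans (sym (+-identityʳ _)) (sym 1+m≡))))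
  unpair-1+m : unpair (suc m) ≡ (diagonal (suc m) ∸ 0 , 0)
  unpair-1+m rewrite unpair-m | next-diagonal | n∸n≡0 b = refl
... | inj₁ b<d = suc b , subst (suc b ≤_) (sym same-diagonal) b<d
               , trans (trans (cong suc m≡) (sym (+-suc _ b))) (cong (λ d → triangle d + suc b) (sym same-diagonal))
               , unpair-1+m
  where
  d = diagonal m
  same-diagonal : diagonal (suc m) ≡ d
  same-diagonal = cong (_+ d) (χ≤-no (begin-strict
    suc m                  ≡⟨ cong suc m≡ ⟩
    suc (triangle d + b)   ≡⟨ +-suc (triangle d) b ⟨
    triangle d + suc b     <⟨ +-monoʳ-< (triangle d) (s≤s b<d) ⟩
    triangle d + suc d     ∎))
    where open ≤-Reasoning
  unpair-1+m : unpair (suc m) ≡ (diagonal (suc m) ∸ suc b , suc b)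
  unpair-1+m rewrite unpair-m | same-diagonal | +-∸-assoc 1 b<d = refl

unpair₁ unpair₂ : ℕ → ℕ
unpair₁ m = proj₁ (unpair m)
unpair₂ m = proj₂ (unpair m)

unpair₂-correct : ∀ m → m ∸ triangle (diagonal m) ≡ unpair₂ m
unpair₂-correct m with unpair-diagonal m
... | b , _ , m≡ , unpair-m = trans (cong (_∸ triangle (diagonal m)) m≡)
                                    (trans (m+n∸m≡n (triangle (diagonal m)) b) (sym (cong proj₂ unpair-m)))

unpair₁-correct : ∀ m → diagonal m ∸ unpair₂ m ≡ unpair₁ m
unpair₁-correct m with unpair-diagonal m
... | b , _ , _ , unpair-m rewrite unpair-m = refl

unpair₂ᶜ : Computable 1
unpair₂ᶜ = computable (∸ᶜ ⟨ v0 ∣ triangleᶜ ⟨ diagonalᶜ ⟨ v0 ⟩ ⟩ ⟩) (λ { (m ∷ []) → unpair₂ m })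
                      λ { (m ∷ []) → unpair₂-correct m }

unpair₁ᶜ : Computable 1
unpair₁ᶜ = computable (∸ᶜ ⟨ diagonalᶜ ⟨ v0 ⟩ ∣ unpair₂ᶜ ⟨ v0 ⟩ ⟩) (λ { (m ∷ []) → unpair₁ m })
                      λ { (m ∷ []) → unpair₁-correct m }

pair-suc-zero : ∀ c → pair (suc c) 0 ≡ suc (pair 0 c)
pair-suc-zero c rewrite pair-definition (suc c) 0 | pair-definition 0 c | +-identityʳ c | +-identityʳ (triangle c + suc c) =
  +-suc (triangle c) c

pair-suc : ∀ a b → pair a (suc b) ≡ suc (pair (suc a) b)
pair-suc a b rewrite pair-definition a (suc b) | pair-definition (suc a) b | +-suc a b = +-suc (triangle (suc (a + b))) b

unpair-pair : ∀ a b → unpair (pair a b) ≡ (a , b)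
unpair-pair a b = on-diagonal (a + b) a b refl
  where
  on-diagonal : ∀ d a b → a + b ≡ d → unpair (pair a b) ≡ (a , b)
  on-diagonal d zero zero _ rewrite pair-definition 0 0 = refl
  on-diagonal (suc d) (suc c) zero a+0≡ rewrite pair-suc-zero c
    | on-diagonal d 0 c (cong pred (trans (sym (+-identityʳ (suc c))) a+0≡)) = refl
  on-diagonal d a (suc b) a+b≡ rewrite pair-suc a b
    | on-diagonal d (suc a) b (trans (sym (+-suc a b)) a+b≡) = refl

unpair₁-pair : ∀ a b → unpair₁ (pair a b) ≡ a
unpair₁-pair a b = cong proj₁ (unpair-pair a b)

unpair₂-pair : ∀ a b → unpair₂ (pair a b) ≡ b
unpair₂-pair a b = cong proj₂ (unpair-pair a b)

n≤triangle : ∀ n → n ≤ triangle n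
n≤triangle zero = z≤n
n≤triangle (suc n) = m≤n+m (suc n) (triangle n)

a+b+b≤pair : ∀ a b → a + b + b ≤ pair a b
a+b+b≤pair a b rewrite pair-definition a b = +-monoˡ-≤ b (n≤triangle (a + b))

a≤pair : ∀ a b → a ≤ pair a b
a≤pair a b = ≤-trans (≤-trans (m≤m+n a b) (m≤m+n (a + b) b)) (a+b+b≤pair a b)

b≤pair : ∀ a b → b ≤ pair a b
b≤pair a b = ≤-trans (m≤n+m b (a + b)) (a+b+b≤pair a b)

b<pair-suc : ∀ a b → b < pair (suc a) b
b<pair-suc a b = ≤-trans (s≤s (m≤n+m b (a + b))) (a+b+b≤pair (suc a) b)

-- Gödel numbers of codes

decodeTag : ℕ → ℕ → ℕ → Code
decodeTag k 0 r = Z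
decodeTag k 1 r = S
decodeTag k 2 r = P r
decodeTag k 3 r = C (decode′ k (unpair₁ r)) (decodeList k (unpair₂ r))
decodeTag k 4 r = R (decode′ k (unpair₁ r)) (decode′ k (unpair₂ r))
decodeTag k 5 r = M (decode′ k r)
decodeTag k (suc (suc (suc (suc (suc (suc _)))))) r = Z

decode′-suc : ∀ k m → decode′ (suc k) m ≡ decodeTag k (unpair₁ m) (unpair₂ m)
decode′-suc k m with unpair m
... | 0 , r = refl
... | 1 , r = refl
... | 2 , r = refl
... | 3 , r = refl
... | 4 , r = refl
... | 5 , r = refl
... | suc (suc (suc (suc (suc (suc _))))) , r = refl

decodeList-suc : ∀ k m → decodeList (suc k) (suc m) ≡ decode′ k (unpair₁ m) ∷ decodeList k (unpair₂ m)
decodeList-suc k m with unpair m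
... | a , b = refl

mutual
  ⌜_⌝ : Code → ℕ
  ⌜ Z ⌝ = pair 0 0
  ⌜ S ⌝ = pair 1 0
  ⌜ P i ⌝ = pair 2 i
  ⌜ C f gs ⌝ = pair 3 (pair ⌜ f ⌝ ⌜ gs ⌝*)
  ⌜ R f g ⌝ = pair 4 (pair ⌜ f ⌝ ⌜ g ⌝)
  ⌜ M f ⌝ = pair 5 ⌜ f ⌝

  ⌜_⌝* : List Code → ℕ
  ⌜ [] ⌝* = 0
  ⌜ c ∷ cs ⌝* = suc (pair ⌜ c ⌝ ⌜ cs ⌝*)

decode′-suc-pair : ∀ k t r → decode′ (suc k) (pair t r) ≡ decodeTag k t r
decode′-suc-pair k t r rewrite decode′-suc k (pair t r) | unpair₁-pair t r | unpair₂-pair t r = refl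

pair-suc≤⇒suc : ∀ {t r k} → pair (suc t) r ≤ k → Σ ℕ λ k′ → k ≡ suc k′
pair-suc≤⇒suc {k = suc k} _ = k , refl
pair-suc≤⇒suc {t} {r} {zero} le with ≤-trans (b<pair-suc t r) le
... | ()

pair-suc-pair≤⇒< : ∀ {t a b k} → pair (suc t) (pair a b) ≤ suc k → a ≤ k × b ≤ k
pair-suc-pair≤⇒< {t} {a} {b} le = ≤-pred (≤-trans (s≤s (a≤pair a b)) pair-ab<)
                                , ≤-pred (≤-trans (s≤s (b≤pair a b)) pair-ab<)
  where
  pair-ab< : pair a b < suc _
  pair-ab< = ≤-trans (b<pair-suc t (pair a b)) le

-- Fuel k ≥ ⌜ c ⌝ suffices, since the components of a code have smaller numbers.
mutual
  decode′-⌜⌝ : ∀ c k → ⌜ c ⌝ ≤ k → decode′ k ⌜ c ⌝ ≡ c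
  decode′-⌜⌝ Z zero _ = refl
  decode′-⌜⌝ Z (suc k) _ = decode′-suc-pair k 0 0
  decode′-⌜⌝ S k le with pair-suc≤⇒suc {0} {0} le
  ... | k′ , refl = decode′-suc-pair k′ 1 0
  decode′-⌜⌝ (P i) k le with pair-suc≤⇒suc {1} {i} le
  ... | k′ , refl = decode′-suc-pair k′ 2 i
  decode′-⌜⌝ (C f gs) k le with pair-suc≤⇒suc {2} {pair ⌜ f ⌝ ⌜ gs ⌝*} le
  ... | k′ , refl = trans (decode′-suc-pair k′ 3 _) (cong₂ C
    (trans (cong (decode′ k′) (unpair₁-pair ⌜ f ⌝ ⌜ gs ⌝*)) (decode′-⌜⌝ f k′ (proj₁ (pair-suc-pair≤⇒< {2} le))))
    (trans (cong (decodeList k′) (unpair₂-pair ⌜ f ⌝ ⌜ gs ⌝*)) (decodeList-⌜⌝* gs k′ (proj₂ (pair-suc-pair≤⇒< {2} le)))))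
  decode′-⌜⌝ (R f g) k le with pair-suc≤⇒suc {3} {pair ⌜ f ⌝ ⌜ g ⌝} le
  ... | k′ , refl = trans (decode′-suc-pair k′ 4 _) (cong₂ R
    (trans (cong (decode′ k′) (unpair₁-pair ⌜ f ⌝ ⌜ g ⌝)) (decode′-⌜⌝ f k′ (proj₁ (pair-suc-pair≤⇒< {3} le))))
    (trans (cong (decode′ k′) (unpair₂-pair ⌜ f ⌝ ⌜ g ⌝)) (decode′-⌜⌝ g k′ (proj₂ (pair-suc-pair≤⇒< {3} le)))))
  decode′-⌜⌝ (M f) k le with pair-suc≤⇒suc {4} {⌜ f ⌝} le
  ... | k′ , refl = trans (decode′-suc-pair k′ 5 _) (cong M (decode′-⌜⌝ f k′ (≤-pred (≤-trans (b<pair-suc 4 ⌜ f ⌝) le))))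

  decodeList-⌜⌝* : ∀ cs k → ⌜ cs ⌝* ≤ k → decodeList k ⌜ cs ⌝* ≡ cs
  decodeList-⌜⌝* [] zero _ = refl
  decodeList-⌜⌝* [] (suc k) _ = refl
  decodeList-⌜⌝* (c ∷ cs) (suc k) (s≤s le) = trans (decodeList-suc k (pair ⌜ c ⌝ ⌜ cs ⌝*)) (cong₂ _∷_
    (trans (cong (decode′ k) (unpair₁-pair ⌜ c ⌝ ⌜ cs ⌝*)) (decode′-⌜⌝ c k (≤-trans (a≤pair _ _) le)))
    (trans (cong (decodeList k) (unpair₂-pair ⌜ c ⌝ ⌜ cs ⌝*)) (decodeList-⌜⌝* cs k (≤-trans (b≤pair _ _) le))))

decode-⌜⌝ : ∀ c → decode ⌜ c ⌝ ≡ c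
decode-⌜⌝ c = decode′-⌜⌝ c ⌜ c ⌝ ≤-refl

-- A small-step abstract machine for the big-step semantics

data Frame : Set where
  compose : Code → List Code → List ℕ → List ℕ → Frame
  recurse : Code → Code → ℕ → ℕ → List ℕ → Frame
  search  : Code → ℕ → List ℕ → Frame

data State : Set where
  eval   : Code → List ℕ → List Frame → State
  return : ℕ → List Frame → State

step : State → State
step (eval Z xs K) = return 0 K
step (eval S xs K) = return (suc (arg 0 xs)) K
step (eval (P i) xs K) = return (arg i xs) K
step (eval (C f []) xs K) = eval f [] K
step (eval (C f (g ∷ gs)) xs K) = eval g xs (compose f gs xs [] ∷ K)
step (eval (R f g) [] K) = eval (R f g) [] K
step (eval (R f g) (n ∷ xs) K) = eval f xs (recurse f g 0 n xs ∷ K)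
step (eval (M f) xs K) = eval f (0 ∷ xs) (search f 0 xs ∷ K)
step (return v []) = return v []
step (return v (compose f [] xs acc ∷ K)) = eval f ((v ∷ acc) ʳ++ []) K
step (return v (compose f (g ∷ gs) xs acc ∷ K)) = eval g xs (compose f gs xs (v ∷ acc) ∷ K)
step (return u (recurse f g i n xs ∷ K)) = ifz ∣ i - n ∣ (return u K) (eval g (i ∷ u ∷ xs) (recurse f g (suc i) n xs ∷ K))
step (return v (search f i xs ∷ K)) = ifz v (return i K) (eval f (suc i ∷ xs) (search f (suc i) xs ∷ K))

infix 4 _↠_
infixr 5 _⟫_

_↠_ : State → State → Set
a ↠ b = Σ ℕ λ s → iterate step a s ≡ b

iterate-+ : ∀ {A : Set} (f : A → A) a m n → iterate f a (m + n) ≡ iterate f (iterate f a m) n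
iterate-+ f a zero n = refl
iterate-+ f a (suc m) n = iterate-+ f (f a) m n

_⟫_ : ∀ {a b c} → a ↠ b → b ↠ c → a ↠ c
_⟫_ {a} (m , a↠b) (n , b↠c) = m + n , trans (iterate-+ step a m n) (trans (cong (λ b → iterate step b n) a↠b) b↠c)

↠-step : ∀ {a b} → step a ≡ b → a ↠ b
↠-step step≡ = 1 , step≡

∣-∣-suc : ∀ {i n} → i < n → Σ ℕ λ k → ∣ i - n ∣ ≡ suc k
∣-∣-suc {zero} {suc n} _ = n , refl
∣-∣-suc {suc i} {suc n} (s≤s i<n) = ∣-∣-suc i<n

mutual
  eval-↠ : ∀ {c xs v} → c [ xs ]⇓ v → ∀ K → eval c xs K ↠ return v K
  eval-↠ ⇓Z K = ↠-step refl
  eval-↠ ⇓S K = ↠-step refl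
  eval-↠ ⇓P K = ↠-step refl
  eval-↠ (⇓C []⇓ f) K = ↠-step refl ⟫ eval-↠ f K
  eval-↠ (⇓C {f = f} {xs = xs} (∷⇓ {gs = gs} g gs⇓) f⇓) K =
    ↠-step refl ⟫ eval-↠ g (compose f gs xs [] ∷ K) ⟫ compose-↠ gs⇓ f⇓
  eval-↠ r@(⇓R0 _) K = recursion-↠ r K
  eval-↠ r@(⇓Rs _ _) K = recursion-↠ r K
  eval-↠ (⇓M {f} {xs} {n} f⇓0 below) K = ↠-step refl ⟫ search-↠ 0 n refl
    where
    search-↠ : ∀ i k → i + k ≡ n → eval f (i ∷ xs) (search f i xs ∷ K) ↠ return n K
    search-↠ i zero i+0≡n rewrite +-identityʳ i | i+0≡n = eval-↠ f⇓0 (search f n xs ∷ K) ⟫ ↠-step refl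
    search-↠ i (suc k) i+k≡n with below i (subst (i <_) i+k≡n (m<m+n i (s≤s z≤n)))
    ... | j , f⇓suc = eval-↠ f⇓suc (search f i xs ∷ K) ⟫ ↠-step refl ⟫ search-↠ (suc i) k (trans (sym (+-suc i k)) i+k≡n)

  compose-↠ : ∀ {gs xs ys f v acc K w} → gs [ xs ]⇓* ys → f [ (v ∷ acc) ʳ++ ys ]⇓ w →
              return v (compose f gs xs acc ∷ K) ↠ return w K
  compose-↠ {K = K} []⇓ f⇓ = ↠-step refl ⟫ eval-↠ f⇓ K
  compose-↠ {xs = xs} {f = f} {v} {acc} {K} (∷⇓ {gs = gs} g gs⇓) f⇓ =
    ↠-step refl ⟫ eval-↠ g (compose f gs xs (v ∷ acc) ∷ K) ⟫ compose-↠ gs⇓ f⇓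

  recursion-↠ : ∀ {f g n xs v} → R f g [ n ∷ xs ]⇓ v → ∀ K → eval (R f g) (n ∷ xs) K ↠ return v K
  recursion-↠ {f} {g} {n} {xs} {v} r K =
    ↠-step refl ⟫ recursion-upto-↠ r n K ≤-refl
           ⟫ ↠-step (cong (λ e → ifz e (return v K) (eval g (n ∷ v ∷ xs) (recurse f g (suc n) n xs ∷ K))) (m≡n⇒∣m-n∣≡0 {n} refl))

  recursion-upto-↠ : ∀ {f g n xs u} → R f g [ n ∷ xs ]⇓ u → ∀ N K → n ≤ N →
                     eval f xs (recurse f g 0 N xs ∷ K) ↠ return u (recurse f g n N xs ∷ K)
  recursion-upto-↠ (⇓R0 f⇓) N K _ = eval-↠ f⇓ _
  recursion-upto-↠ {f} {g} {suc n} {xs} (⇓Rs {u = u} r g⇓) N K 1+n≤N with ∣-∣-suc {n} {N} 1+n≤N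
  ... | k , ∣n-N∣≡ = recursion-upto-↠ r N K (≤-trans (n≤1+n n) 1+n≤N)
                  ⟫ ↠-step (cong (λ e → ifz e (return u K) (eval g (n ∷ u ∷ xs) (recurse f g (suc n) N xs ∷ K))) ∣n-N∣≡)
                  ⟫ eval-↠ g⇓ _

-- Resumes K v w: returning v to the stack K eventually yields w.
Resumes : List Frame → ℕ → ℕ → Set
Resumes [] v w = v ≡ w
Resumes (compose f gs xs acc ∷ K) v w =
  Σ (List ℕ) λ ys → gs [ xs ]⇓* ys × Σ ℕ λ r → f [ (v ∷ acc) ʳ++ ys ]⇓ r × Resumes K r w
Resumes (recurse f g i n xs ∷ K) u w =
  R f g [ i ∷ xs ]⇓ u → Σ ℕ λ r → R f g [ n ∷ xs ]⇓ r × Resumes K r w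
Resumes (search f i xs ∷ K) v w =
  f [ i ∷ xs ]⇓ v → (∀ m → m < i → Σ ℕ λ k → f [ m ∷ xs ]⇓ suc k) → Σ ℕ λ r → M f [ xs ]⇓ r × Resumes K r w

Finishes : State → ℕ → Set
Finishes (eval c xs K) w = Σ ℕ λ v → c [ xs ]⇓ v × Resumes K v w
Finishes (return v K) w = Resumes K v w

Finishes-step⁻¹ : ∀ s {w} → Finishes (step s) w → Finishes s w
Finishes-step⁻¹ (eval Z xs K) k = 0 , ⇓Z , k
Finishes-step⁻¹ (eval S xs K) k = _ , ⇓S , k
Finishes-step⁻¹ (eval (P i) xs K) k = _ , ⇓P , k
Finishes-step⁻¹ (eval (C f []) xs K) (r , f⇓ , k) = r , ⇓C []⇓ f⇓ , k
Finishes-step⁻¹ (eval (C f (g ∷ gs)) xs K) (v , g⇓ , ys , gs⇓ , r , f⇓ , k) = r , ⇓C (∷⇓ g⇓ gs⇓) f⇓ , k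
Finishes-step⁻¹ (eval (R f g) [] K) loops = loops
Finishes-step⁻¹ (eval (R f g) (n ∷ xs) K) (v , f⇓ , k) = k (⇓R0 f⇓)
Finishes-step⁻¹ (eval (M f) xs K) (v , f⇓ , k) = k f⇓ (λ m ())
Finishes-step⁻¹ (return v []) done = done
Finishes-step⁻¹ (return v (compose f [] xs acc ∷ K)) (r , f⇓ , k) = [] , []⇓ , r , f⇓ , k
Finishes-step⁻¹ (return v (compose f (g ∷ gs) xs acc ∷ K)) (y , g⇓ , ys , gs⇓ , r , f⇓ , k) =
  y ∷ ys , ∷⇓ g⇓ gs⇓ , r , f⇓ , k
Finishes-step⁻¹ (return u (recurse f g i n xs ∷ K)) k with ∣ i - n ∣ in ∣i-n∣≡
... | zero with ∣m-n∣≡0⇒m≡n {i} {n} ∣i-n∣≡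
...   | refl = λ r⇓ → u , r⇓ , k
Finishes-step⁻¹ (return u (recurse f g i n xs ∷ K)) (v , g⇓ , k) | suc _ = λ r⇓ → k (⇓Rs r⇓ g⇓)
Finishes-step⁻¹ (return zero (search f i xs ∷ K)) k = λ f⇓ below → i , ⇓M f⇓ below , k
Finishes-step⁻¹ (return (suc j) (search f i xs ∷ K)) (v , f⇓′ , k) = λ f⇓ below → k f⇓′ (below′ f⇓ below)
  where
  below′ : f [ i ∷ xs ]⇓ suc j → (∀ m → m < i → Σ ℕ λ k → f [ m ∷ xs ]⇓ suc k) →
           ∀ m → m < suc i → Σ ℕ λ k → f [ m ∷ xs ]⇓ suc k
  below′ f⇓ below m m<1+i with m≤n⇒m<n∨m≡n (≤-pred m<1+i)
  ... | inj₁ m<i = below m m<i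
  ... | inj₂ refl = j , f⇓

Finishes-iterate⁻¹ : ∀ s n {w} → iterate step s n ≡ return w [] → Finishes s w
Finishes-iterate⁻¹ s zero refl = refl
Finishes-iterate⁻¹ s (suc n) halts = Finishes-step⁻¹ s (Finishes-iterate⁻¹ (step s) n halts)

machine-sound : ∀ {c xs w} → eval c xs [] ↠ return w [] → c [ xs ]⇓ w
machine-sound {c} {xs} (n , halts) with Finishes-iterate⁻¹ (eval c xs []) n halts
... | v , c⇓ , refl = c⇓

machine-complete : ∀ {c xs w} → c [ xs ]⇓ w → eval c xs [] ↠ return w []
machine-complete c⇓ = eval-↠ c⇓ []

-- Arithmetisation of the machine

cons : ℕ → ℕ → ℕ
cons x l = suc (pair x l)

head tail : ℕ → ℕ
head l = unpair₁ (pred l)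
tail l = unpair₂ (pred l)

encodeList : List ℕ → ℕ
encodeList [] = 0
encodeList (x ∷ xs) = cons x (encodeList xs)

argₙ : ℕ → ℕ → ℕ
argₙ i l = head (iterate tail l i)

reverseStep : ℕ → ℕ
reverseStep st = ifz (unpair₁ st) st (pair (tail (unpair₁ st)) (cons (head (unpair₁ st)) (unpair₂ st)))

reverseₙ : ℕ → ℕ
reverseₙ l = unpair₂ (iterate reverseStep (pair l 0) l)

consᶜ : Computable 2
consᶜ = computable (suc (pairᶜ ⟨ v0 ∣ v1 ⟩)) (λ { (x ∷ l ∷ []) → cons x l }) λ { (x ∷ l ∷ []) → refl }

headᶜ : Computable 1
headᶜ = computable (unpair₁ᶜ ⟨ predᶜ ⟨ v0 ⟩ ⟩) (λ { (l ∷ []) → head l }) λ { (l ∷ []) → refl }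

tailᶜ : Computable 1
tailᶜ = computable (unpair₂ᶜ ⟨ predᶜ ⟨ v0 ⟩ ⟩) (λ { (l ∷ []) → tail l }) λ { (l ∷ []) → refl }

argᶜ : Computable 2
argᶜ = computable (headᶜ ⟨ rec v0 v1 (tailᶜ ⟨ v1 ⟩) ⟩) (λ { (i ∷ l ∷ []) → argₙ i l })
  λ { (i ∷ l ∷ []) → cong head (recursion-iterate tailᶜ (i ∷ l ∷ []) l i) }

reverseStepᶜ : Computable 1
reverseStepᶜ = computable
  (ifzᶜ ⟨ unpair₁ᶜ ⟨ v0 ⟩ ∣ v0 ∣ pairᶜ ⟨ tailᶜ ⟨ unpair₁ᶜ ⟨ v0 ⟩ ⟩
                                 ∣ consᶜ ⟨ headᶜ ⟨ unpair₁ᶜ ⟨ v0 ⟩ ⟩ ∣ unpair₂ᶜ ⟨ v0 ⟩ ⟩ ⟩ ⟩)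
  (λ { (st ∷ []) → reverseStep st }) λ { (st ∷ []) → refl }

reverseᶜ : Computable 1
reverseᶜ = computable (unpair₂ᶜ ⟨ rec v0 (pairᶜ ⟨ v0 ∣ zero ⟩) (reverseStepᶜ ⟨ v1 ⟩) ⟩) (λ { (l ∷ []) → reverseₙ l })
  λ { (l ∷ []) → cong unpair₂ (recursion-iterate reverseStepᶜ (l ∷ []) (pair l 0) l) }

head-cons : ∀ x l → head (cons x l) ≡ x
head-cons = unpair₁-pair

tail-cons : ∀ x l → tail (cons x l) ≡ l
tail-cons = unpair₂-pair

iterate-fixed : ∀ {A : Set} (f : A → A) {a} → f a ≡ a → ∀ n → iterate f a n ≡ a
iterate-fixed f fa≡a zero = refl
iterate-fixed f fa≡a (suc n) = trans (cong (λ a → iterate f a n) fa≡a) (iterate-fixed f fa≡a n)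

argₙ-correct : ∀ i xs → argₙ i (encodeList xs) ≡ arg i xs
argₙ-correct zero [] = refl
argₙ-correct zero (x ∷ xs) = head-cons x (encodeList xs)
argₙ-correct (suc i) [] = cong head (iterate-fixed tail refl i)
argₙ-correct (suc i) (x ∷ xs) = trans (cong (λ l → head (iterate tail l i)) (tail-cons x (encodeList xs))) (argₙ-correct i xs)

length≤encodeList : ∀ xs → length xs ≤ encodeList xs
length≤encodeList [] = z≤n
length≤encodeList (x ∷ xs) = s≤s (≤-trans (length≤encodeList xs) (b≤pair x (encodeList xs)))

reverseStep-iterate : ∀ xs ys n → length xs ≤ n →
                      iterate reverseStep (pair (encodeList xs) (encodeList ys)) n ≡ pair 0 (encodeList (xs ʳ++ ys))
reverseStep-iterate [] ys n _ = iterate-fixed reverseStep done n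
  where
  done : reverseStep (pair 0 (encodeList ys)) ≡ pair 0 (encodeList ys)
  done rewrite unpair₁-pair 0 (encodeList ys) = refl
reverseStep-iterate (x ∷ xs) ys (suc n) (s≤s |xs|≤n) =
  trans (cong (λ st → iterate reverseStep st n) one-step) (reverseStep-iterate xs (x ∷ ys) n |xs|≤n)
  where
  one-step : reverseStep (pair (encodeList (x ∷ xs)) (encodeList ys)) ≡ pair (encodeList xs) (encodeList (x ∷ ys))
  one-step rewrite unpair₁-pair (cons x (encodeList xs)) (encodeList ys) | unpair₂-pair (cons x (encodeList xs)) (encodeList ys)
                 | head-cons x (encodeList xs) | tail-cons x (encodeList xs) = refl

reverseₙ-correct : ∀ xs → reverseₙ (encodeList xs) ≡ encodeList (xs ʳ++ [])
reverseₙ-correct xs = trans (cong unpair₂ (reverseStep-iterate xs [] (encodeList xs) (length≤encodeList xs))) (unpair₂-pair 0 _)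

returnₙ : ℕ → ℕ → ℕ
returnₙ v K = pair 1 (pair v K)

evalₙ : ℕ → ℕ → ℕ → ℕ
evalₙ c xs K = pair 0 (pair c (pair xs K))

composeₙ : ℕ → ℕ → ℕ → ℕ → ℕ
composeₙ f gs xs acc = pair 0 (pair f (pair gs (pair xs acc)))

recurseₙ : ℕ → ℕ → ℕ → ℕ → ℕ → ℕ
recurseₙ f g i n xs = pair 1 (pair f (pair g (pair i (pair n xs))))

searchₙ : ℕ → ℕ → ℕ → ℕ
searchₙ f i xs = pair 2 (pair f (pair i xs))

returnᶜ : Computable 2
returnᶜ = computable (pairᶜ ⟨ lit 1 ∣ pairᶜ ⟨ v0 ∣ v1 ⟩ ⟩) (λ { (v ∷ K ∷ []) → returnₙ v K }) λ { (v ∷ K ∷ []) → refl }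

evalᶜ : Computable 3
evalᶜ = computable (pairᶜ ⟨ zero ∣ pairᶜ ⟨ v0 ∣ pairᶜ ⟨ v1 ∣ v2 ⟩ ⟩ ⟩) (λ { (c ∷ xs ∷ K ∷ []) → evalₙ c xs K })
                   λ { (c ∷ xs ∷ K ∷ []) → refl }

composeᶜ : Computable 4
composeᶜ = computable (pairᶜ ⟨ zero ∣ pairᶜ ⟨ v0 ∣ pairᶜ ⟨ v1 ∣ pairᶜ ⟨ v2 ∣ v3 ⟩ ⟩ ⟩ ⟩)
                      (λ { (f ∷ gs ∷ xs ∷ acc ∷ []) → composeₙ f gs xs acc }) λ { (f ∷ gs ∷ xs ∷ acc ∷ []) → refl }

recurseᶜ : Computable 5
recurseᶜ = computable (pairᶜ ⟨ lit 1 ∣ pairᶜ ⟨ v0 ∣ pairᶜ ⟨ v1 ∣ pairᶜ ⟨ v2 ∣ pairᶜ ⟨ v3 ∣ v4 ⟩ ⟩ ⟩ ⟩ ⟩)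
                      (λ { (f ∷ g ∷ i ∷ n ∷ xs ∷ []) → recurseₙ f g i n xs }) λ { (f ∷ g ∷ i ∷ n ∷ xs ∷ []) → refl }

searchᶜ : Computable 3
searchᶜ = computable (pairᶜ ⟨ lit 2 ∣ pairᶜ ⟨ v0 ∣ pairᶜ ⟨ v1 ∣ v2 ⟩ ⟩ ⟩) (λ { (f ∷ i ∷ xs ∷ []) → searchₙ f i xs })
                     λ { (f ∷ i ∷ xs ∷ []) → refl }

-- The code decode′ k m is represented by pair k m, so that its components are again
-- represented by pairs with fuel pred k.  The last argument s of the step functions is the
-- current state, returned unchanged when the machine is stuck.

evalC : ℕ → ℕ → ℕ → ℕ → ℕ → ℕ
evalC k a b xs K =
  ifz k (evalₙ (pair k a) 0 K) (ifz b (evalₙ (pair k a) 0 K)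
  (evalₙ (pair (pred k) (unpair₁ (pred b))) xs (cons (composeₙ (pair k a) (pair (pred k) (unpair₂ (pred b))) xs 0) K)))

evalCᶜ : Computable 5
evalCᶜ = computable (ifzᶜ ⟨ v0 ∣ noArgs ∣ ifzᶜ ⟨ v2 ∣ noArgs ∣ firstArg ⟩ ⟩)
                    (λ { (k ∷ a ∷ b ∷ xs ∷ K ∷ []) → evalC k a b xs K }) λ { (k ∷ a ∷ b ∷ xs ∷ K ∷ []) → refl }
  where
  noArgs firstArg : Term 5
  noArgs = evalᶜ ⟨ pairᶜ ⟨ v0 ∣ v1 ⟩ ∣ zero ∣ v4 ⟩
  firstArg = evalᶜ ⟨ pairᶜ ⟨ predᶜ ⟨ v0 ⟩ ∣ unpair₁ᶜ ⟨ predᶜ ⟨ v2 ⟩ ⟩ ⟩ ∣ v3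
                   ∣ consᶜ ⟨ composeᶜ ⟨ pairᶜ ⟨ v0 ∣ v1 ⟩ ∣ pairᶜ ⟨ predᶜ ⟨ v0 ⟩ ∣ unpair₂ᶜ ⟨ predᶜ ⟨ v2 ⟩ ⟩ ⟩ ∣ v3 ∣ zero ⟩ ∣ v4 ⟩ ⟩

evalR : ℕ → ℕ → ℕ → ℕ → ℕ → ℕ → ℕ
evalR k a b xs K s = ifz xs s (evalₙ (pair k a) (tail xs) (cons (recurseₙ (pair k a) (pair k b) 0 (head xs) (tail xs)) K))

evalRᶜ : Computable 6
evalRᶜ = computable
  (ifzᶜ ⟨ v3 ∣ v5 ∣ evalᶜ ⟨ pairᶜ ⟨ v0 ∣ v1 ⟩ ∣ tailᶜ ⟨ v3 ⟩
                          ∣ consᶜ ⟨ recurseᶜ ⟨ pairᶜ ⟨ v0 ∣ v1 ⟩ ∣ pairᶜ ⟨ v0 ∣ v2 ⟩ ∣ zero ∣ headᶜ ⟨ v3 ⟩ ∣ tailᶜ ⟨ v3 ⟩ ⟩ ∣ v4 ⟩ ⟩ ⟩)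
  (λ { (k ∷ a ∷ b ∷ xs ∷ K ∷ s ∷ []) → evalR k a b xs K s }) λ { (k ∷ a ∷ b ∷ xs ∷ K ∷ s ∷ []) → refl }

evalM : ℕ → ℕ → ℕ → ℕ → ℕ
evalM k r xs K = evalₙ (pair k r) (cons 0 xs) (cons (searchₙ (pair k r) 0 xs) K)

evalMᶜ : Computable 4
evalMᶜ = computable
  (evalᶜ ⟨ pairᶜ ⟨ v0 ∣ v1 ⟩ ∣ consᶜ ⟨ zero ∣ v2 ⟩ ∣ consᶜ ⟨ searchᶜ ⟨ pairᶜ ⟨ v0 ∣ v1 ⟩ ∣ zero ∣ v2 ⟩ ∣ v3 ⟩ ⟩)
                    (λ { (k ∷ r ∷ xs ∷ K ∷ []) → evalM k r xs K }) λ { (k ∷ r ∷ xs ∷ K ∷ []) → refl }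

evalTag : ℕ → ℕ → ℕ → ℕ → ℕ → ℕ → ℕ
evalTag k tag r xs K s =
  ifz tag (returnₙ 0 K)
  (ifz (pred tag) (returnₙ (suc (head xs)) K)
  (ifz (pred (pred tag)) (returnₙ (argₙ r xs) K)
  (ifz (pred (pred (pred tag))) (evalC k (unpair₁ r) (unpair₂ r) xs K)
  (ifz (pred (pred (pred (pred tag)))) (evalR k (unpair₁ r) (unpair₂ r) xs K s)
  (ifz (pred (pred (pred (pred (pred tag))))) (evalM k r xs K)
  (returnₙ 0 K))))))

evalTagᶜ : Computable 6
evalTagᶜ = computable
  (ifzᶜ ⟨ v1 ∣ returnᶜ ⟨ zero ∣ v4 ⟩
  ∣ ifzᶜ ⟨ p v1 ∣ returnᶜ ⟨ suc (headᶜ ⟨ v3 ⟩) ∣ v4 ⟩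
  ∣ ifzᶜ ⟨ p (p v1) ∣ returnᶜ ⟨ argᶜ ⟨ v2 ∣ v3 ⟩ ∣ v4 ⟩
  ∣ ifzᶜ ⟨ p (p (p v1)) ∣ evalCᶜ ⟨ v0 ∣ unpair₁ᶜ ⟨ v2 ⟩ ∣ unpair₂ᶜ ⟨ v2 ⟩ ∣ v3 ∣ v4 ⟩
  ∣ ifzᶜ ⟨ p (p (p (p v1))) ∣ evalRᶜ ⟨ v0 ∣ unpair₁ᶜ ⟨ v2 ⟩ ∣ unpair₂ᶜ ⟨ v2 ⟩ ∣ v3 ∣ v4 ∣ v5 ⟩
  ∣ ifzᶜ ⟨ p (p (p (p (p v1)))) ∣ evalMᶜ ⟨ v0 ∣ v2 ∣ v3 ∣ v4 ⟩
  ∣ returnᶜ ⟨ zero ∣ v4 ⟩ ⟩ ⟩ ⟩ ⟩ ⟩ ⟩)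
  (λ { (k ∷ tag ∷ r ∷ xs ∷ K ∷ s ∷ []) → evalTag k tag r xs K s }) λ { (k ∷ tag ∷ r ∷ xs ∷ K ∷ s ∷ []) → refl }
  where
  p : Term 6 → Term 6
  p t = predᶜ ⟨ t ⟩

evalStep : ℕ → ℕ → ℕ → ℕ → ℕ
evalStep c xs K s = ifz (unpair₁ c) (returnₙ 0 K) (evalTag (pred (unpair₁ c)) (unpair₁ (unpair₂ c)) (unpair₂ (unpair₂ c)) xs K s)

evalStepᶜ : Computable 4
evalStepᶜ = computable
  (ifzᶜ ⟨ unpair₁ᶜ ⟨ v0 ⟩ ∣ returnᶜ ⟨ zero ∣ v2 ⟩
        ∣ evalTagᶜ ⟨ predᶜ ⟨ unpair₁ᶜ ⟨ v0 ⟩ ⟩ ∣ unpair₁ᶜ ⟨ unpair₂ᶜ ⟨ v0 ⟩ ⟩ ∣ unpair₂ᶜ ⟨ unpair₂ᶜ ⟨ v0 ⟩ ⟩ ∣ v1 ∣ v2 ∣ v3 ⟩ ⟩)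
  (λ { (c ∷ xs ∷ K ∷ s ∷ []) → evalStep c xs K s }) λ { (c ∷ xs ∷ K ∷ s ∷ []) → refl }

returnC : ℕ → ℕ → ℕ → ℕ → ℕ → ℕ → ℕ
returnC f gs xs acc v K =
  ifz (unpair₁ gs) (evalₙ f (reverseₙ (cons v acc)) K)
  (ifz (unpair₂ gs) (evalₙ f (reverseₙ (cons v acc)) K)
  (evalₙ (pair (pred (unpair₁ gs)) (unpair₁ (pred (unpair₂ gs)))) xs
         (cons (composeₙ f (pair (pred (unpair₁ gs)) (unpair₂ (pred (unpair₂ gs)))) xs (cons v acc)) K)))

returnCᶜ : Computable 6
returnCᶜ = computable (ifzᶜ ⟨ unpair₁ᶜ ⟨ v1 ⟩ ∣ lastArg ∣ ifzᶜ ⟨ unpair₂ᶜ ⟨ v1 ⟩ ∣ lastArg ∣ nextArg ⟩ ⟩)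
  (λ { (f ∷ gs ∷ xs ∷ acc ∷ v ∷ K ∷ []) → returnC f gs xs acc v K }) λ { (f ∷ gs ∷ xs ∷ acc ∷ v ∷ K ∷ []) → refl }
  where
  lastArg nextArg : Term 6
  lastArg = evalᶜ ⟨ v0 ∣ reverseᶜ ⟨ consᶜ ⟨ v4 ∣ v3 ⟩ ⟩ ∣ v5 ⟩
  nextArg = evalᶜ ⟨ pairᶜ ⟨ predᶜ ⟨ unpair₁ᶜ ⟨ v1 ⟩ ⟩ ∣ unpair₁ᶜ ⟨ predᶜ ⟨ unpair₂ᶜ ⟨ v1 ⟩ ⟩ ⟩ ⟩ ∣ v2
                  ∣ consᶜ ⟨ composeᶜ ⟨ v0 ∣ pairᶜ ⟨ predᶜ ⟨ unpair₁ᶜ ⟨ v1 ⟩ ⟩ ∣ unpair₂ᶜ ⟨ predᶜ ⟨ unpair₂ᶜ ⟨ v1 ⟩ ⟩ ⟩ ⟩ ∣ v2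
                                        ∣ consᶜ ⟨ v4 ∣ v3 ⟩ ⟩ ∣ v5 ⟩ ⟩

returnR : ℕ → ℕ → ℕ → ℕ → ℕ → ℕ → ℕ → ℕ
returnR f g i n xs v K = ifz ∣ i - n ∣ (returnₙ v K) (evalₙ g (cons i (cons v xs)) (cons (recurseₙ f g (suc i) n xs) K))

returnRᶜ : Computable 7
returnRᶜ = computable
  (ifzᶜ ⟨ ∣-∣ᶜ ⟨ v2 ∣ v3 ⟩ ∣ returnᶜ ⟨ v5 ∣ v6 ⟩
        ∣ evalᶜ ⟨ v1 ∣ consᶜ ⟨ v2 ∣ consᶜ ⟨ v5 ∣ v4 ⟩ ⟩ ∣ consᶜ ⟨ recurseᶜ ⟨ v0 ∣ v1 ∣ suc v2 ∣ v3 ∣ v4 ⟩ ∣ v6 ⟩ ⟩ ⟩)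
  (λ { (f ∷ g ∷ i ∷ n ∷ xs ∷ v ∷ K ∷ []) → returnR f g i n xs v K }) λ { (f ∷ g ∷ i ∷ n ∷ xs ∷ v ∷ K ∷ []) → refl }

returnM : ℕ → ℕ → ℕ → ℕ → ℕ → ℕ
returnM f i xs v K = ifz v (returnₙ i K) (evalₙ f (cons (suc i) xs) (cons (searchₙ f (suc i) xs) K))

returnMᶜ : Computable 5
returnMᶜ = computable
  (ifzᶜ ⟨ v3 ∣ returnᶜ ⟨ v1 ∣ v4 ⟩
        ∣ evalᶜ ⟨ v0 ∣ consᶜ ⟨ suc v1 ∣ v2 ⟩ ∣ consᶜ ⟨ searchᶜ ⟨ v0 ∣ suc v1 ∣ v2 ⟩ ∣ v4 ⟩ ⟩ ⟩)
  (λ { (f ∷ i ∷ xs ∷ v ∷ K ∷ []) → returnM f i xs v K }) λ { (f ∷ i ∷ xs ∷ v ∷ K ∷ []) → refl }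

returnFrame : ℕ → ℕ → ℕ → ℕ → ℕ
returnFrame tag b v K =
  ifz tag (returnC (π₁ b) (π₁ (π₂ b)) (π₁ (π₂ (π₂ b))) (π₂ (π₂ (π₂ b))) v K)
  (ifz (pred tag) (returnR (π₁ b) (π₁ (π₂ b)) (π₁ (π₂ (π₂ b))) (π₁ (π₂ (π₂ (π₂ b)))) (π₂ (π₂ (π₂ (π₂ b)))) v K)
  (returnM (π₁ b) (π₁ (π₂ b)) (π₂ (π₂ b)) v K))
  where
  π₁ = unpair₁
  π₂ = unpair₂

returnFrameᶜ : Computable 4
returnFrameᶜ = computable
  (ifzᶜ ⟨ v0 ∣ returnCᶜ ⟨ π₁ v1 ∣ π₁ (π₂ v1) ∣ π₁ (π₂ (π₂ v1)) ∣ π₂ (π₂ (π₂ v1)) ∣ v2 ∣ v3 ⟩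
  ∣ ifzᶜ ⟨ predᶜ ⟨ v0 ⟩
  ∣ returnRᶜ ⟨ π₁ v1 ∣ π₁ (π₂ v1) ∣ π₁ (π₂ (π₂ v1)) ∣ π₁ (π₂ (π₂ (π₂ v1))) ∣ π₂ (π₂ (π₂ (π₂ v1))) ∣ v2 ∣ v3 ⟩
  ∣ returnMᶜ ⟨ π₁ v1 ∣ π₁ (π₂ v1) ∣ π₂ (π₂ v1) ∣ v2 ∣ v3 ⟩ ⟩ ⟩)
  (λ { (tag ∷ b ∷ v ∷ K ∷ []) → returnFrame tag b v K }) λ { (tag ∷ b ∷ v ∷ K ∷ []) → refl }
  where
  π₁ π₂ : Term 4 → Term 4
  π₁ t = unpair₁ᶜ ⟨ t ⟩
  π₂ t = unpair₂ᶜ ⟨ t ⟩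

returnStep : ℕ → ℕ → ℕ → ℕ
returnStep v K s = ifz K s (returnFrame (unpair₁ (head K)) (unpair₂ (head K)) v (tail K))

returnStepᶜ : Computable 3
returnStepᶜ = computable
  (ifzᶜ ⟨ v1 ∣ v2 ∣ returnFrameᶜ ⟨ unpair₁ᶜ ⟨ headᶜ ⟨ v1 ⟩ ⟩ ∣ unpair₂ᶜ ⟨ headᶜ ⟨ v1 ⟩ ⟩ ∣ v0 ∣ tailᶜ ⟨ v1 ⟩ ⟩ ⟩)
  (λ { (v ∷ K ∷ s ∷ []) → returnStep v K s }) λ { (v ∷ K ∷ s ∷ []) → refl }

stepₙ : ℕ → ℕ
stepₙ s = ifz (π₁ s) (evalStep (π₁ (π₂ s)) (π₁ (π₂ (π₂ s))) (π₂ (π₂ (π₂ s))) s)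
                     (returnStep (π₁ (π₂ s)) (π₂ (π₂ s)) s)
  where
  π₁ = unpair₁
  π₂ = unpair₂

stepₙᶜ : Computable 1
stepₙᶜ = computable
  (ifzᶜ ⟨ π₁ v0 ∣ evalStepᶜ ⟨ π₁ (π₂ v0) ∣ π₁ (π₂ (π₂ v0)) ∣ π₂ (π₂ (π₂ v0)) ∣ v0 ⟩
                ∣ returnStepᶜ ⟨ π₁ (π₂ v0) ∣ π₂ (π₂ v0) ∣ v0 ⟩ ⟩)
  (λ { (s ∷ []) → stepₙ s }) λ { (s ∷ []) → refl }
  where
  π₁ π₂ : Term 1 → Term 1
  π₁ t = unpair₁ᶜ ⟨ t ⟩
  π₂ t = unpair₂ᶜ ⟨ t ⟩

data CodeRep : ℕ → Code → Set where
  code-rep : ∀ k m → CodeRep (pair k m) (decode′ k m)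

data CodesRep : ℕ → List Code → Set where
  codes-rep : ∀ k m → CodesRep (pair k m) (decodeList k m)

data FrameRep : ℕ → Frame → Set where
  compose-rep : ∀ {fₙ f gsₙ gs} → CodeRep fₙ f → CodesRep gsₙ gs → ∀ xs acc →
                FrameRep (composeₙ fₙ gsₙ (encodeList xs) (encodeList acc)) (compose f gs xs acc)
  recurse-rep : ∀ {fₙ f gₙ g} → CodeRep fₙ f → CodeRep gₙ g → ∀ i n xs →
                FrameRep (recurseₙ fₙ gₙ i n (encodeList xs)) (recurse f g i n xs)
  search-rep  : ∀ {fₙ f} → CodeRep fₙ f → ∀ i xs → FrameRep (searchₙ fₙ i (encodeList xs)) (search f i xs)

data StackRep : ℕ → List Frame → Set where
  []-rep : StackRep 0 []
  ∷-rep  : ∀ {a b F K} → FrameRep a F → StackRep b K → StackRep (cons a b) (F ∷ K)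

data StateRep : ℕ → State → Set where
  eval-rep   : ∀ {cₙ c Kₙ K} → CodeRep cₙ c → ∀ xs → StackRep Kₙ K →
               StateRep (evalₙ cₙ (encodeList xs) Kₙ) (eval c xs K)
  return-rep : ∀ {Kₙ K} v → StackRep Kₙ K → StateRep (returnₙ v Kₙ) (return v K)

StateRep-≡ : ∀ {m n s} → m ≡ n → StateRep n s → StateRep m s
StateRep-≡ refl rep = rep

stepₙ-evalₙ : ∀ c xs K → stepₙ (evalₙ c xs K) ≡ evalStep c xs K (evalₙ c xs K)
stepₙ-evalₙ c xs K rewrite unpair₁-pair 0 (pair c (pair xs K)) | unpair₂-pair 0 (pair c (pair xs K))
  | unpair₁-pair c (pair xs K) | unpair₂-pair c (pair xs K) | unpair₁-pair xs K | unpair₂-pair xs K = refl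

stepₙ-returnₙ : ∀ v K → stepₙ (returnₙ v K) ≡ returnStep v K (returnₙ v K)
stepₙ-returnₙ v K rewrite unpair₁-pair 1 (pair v K) | unpair₂-pair 1 (pair v K) | unpair₁-pair v K | unpair₂-pair v K = refl

evalStep-pair : ∀ k m xs K s →
  evalStep (pair k m) xs K s ≡ ifz k (returnₙ 0 K) (evalTag (pred k) (unpair₁ m) (unpair₂ m) xs K s)
evalStep-pair k m xs K s rewrite unpair₁-pair k m | unpair₂-pair k m = refl

returnStep-cons : ∀ v a b s → returnStep v (cons a b) s ≡ returnFrame (unpair₁ a) (unpair₂ a) v b
returnStep-cons v a b s rewrite head-cons a b | tail-cons a b = refl

returnFrame-composeₙ : ∀ f gs xs acc v K →
  returnFrame (unpair₁ (composeₙ f gs xs acc)) (unpair₂ (composeₙ f gs xs acc)) v K ≡ returnC f gs xs acc v K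
returnFrame-composeₙ f gs xs acc v K
  rewrite unpair₁-pair 0 (pair f (pair gs (pair xs acc))) | unpair₂-pair 0 (pair f (pair gs (pair xs acc)))
        | unpair₁-pair f (pair gs (pair xs acc)) | unpair₂-pair f (pair gs (pair xs acc))
        | unpair₁-pair gs (pair xs acc) | unpair₂-pair gs (pair xs acc) | unpair₁-pair xs acc | unpair₂-pair xs acc = refl

returnFrame-recurseₙ : ∀ f g i n xs v K →
  returnFrame (unpair₁ (recurseₙ f g i n xs)) (unpair₂ (recurseₙ f g i n xs)) v K ≡ returnR f g i n xs v K
returnFrame-recurseₙ f g i n xs v K
  rewrite unpair₁-pair 1 (pair f (pair g (pair i (pair n xs)))) | unpair₂-pair 1 (pair f (pair g (pair i (pair n xs))))
        | unpair₁-pair f (pair g (pair i (pair n xs))) | unpair₂-pair f (pair g (pair i (pair n xs)))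
        | unpair₁-pair g (pair i (pair n xs)) | unpair₂-pair g (pair i (pair n xs))
        | unpair₁-pair i (pair n xs) | unpair₂-pair i (pair n xs) | unpair₁-pair n xs | unpair₂-pair n xs = refl

returnFrame-searchₙ : ∀ f i xs v K →
  returnFrame (unpair₁ (searchₙ f i xs)) (unpair₂ (searchₙ f i xs)) v K ≡ returnM f i xs v K
returnFrame-searchₙ f i xs v K
  rewrite unpair₁-pair 2 (pair f (pair i xs)) | unpair₂-pair 2 (pair f (pair i xs))
        | unpair₁-pair f (pair i xs) | unpair₂-pair f (pair i xs) | unpair₁-pair i xs | unpair₂-pair i xs = refl

evalC-simulates : ∀ k a b xs {Kₙ K} → StackRep Kₙ K →
                  StateRep (evalC k a b (encodeList xs) Kₙ) (step (eval (C (decode′ k a) (decodeList k b)) xs K))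
evalC-simulates zero a b xs K-rep = eval-rep (code-rep 0 a) [] K-rep
evalC-simulates (suc k) a zero xs K-rep = eval-rep (code-rep (suc k) a) [] K-rep
evalC-simulates (suc k) a (suc b) xs K-rep rewrite decodeList-suc k b =
  eval-rep (code-rep k (unpair₁ b)) xs (∷-rep (compose-rep (code-rep (suc k) a) (codes-rep k (unpair₂ b)) xs []) K-rep)

evalTag-simulates : ∀ {cₙ} k tag r xs {Kₙ K} → CodeRep cₙ (decodeTag k tag r) → StackRep Kₙ K →
                    StateRep (evalTag k tag r (encodeList xs) Kₙ (evalₙ cₙ (encodeList xs) Kₙ))
                             (step (eval (decodeTag k tag r) xs K))
evalTag-simulates k 0 r xs _ K-rep = return-rep 0 K-rep
evalTag-simulates k 1 r xs {Kₙ} _ K-rep = StateRep-≡ (cong (λ v → returnₙ (suc v) Kₙ) (argₙ-correct 0 xs)) (return-rep _ K-rep)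
evalTag-simulates k 2 r xs {Kₙ} _ K-rep = StateRep-≡ (cong (λ v → returnₙ v Kₙ) (argₙ-correct r xs)) (return-rep _ K-rep)
evalTag-simulates k 3 r xs _ K-rep = evalC-simulates k (unpair₁ r) (unpair₂ r) xs K-rep
evalTag-simulates k 4 r [] c-rep K-rep = eval-rep c-rep [] K-rep
evalTag-simulates k 4 r (x ∷ xs) _ K-rep rewrite head-cons x (encodeList xs) | tail-cons x (encodeList xs) =
  eval-rep (code-rep k (unpair₁ r)) xs (∷-rep (recurse-rep (code-rep k (unpair₁ r)) (code-rep k (unpair₂ r)) 0 x xs) K-rep)
evalTag-simulates k 5 r xs _ K-rep = eval-rep (code-rep k r) (0 ∷ xs) (∷-rep (search-rep (code-rep k r) 0 xs) K-rep)
evalTag-simulates k (suc (suc (suc (suc (suc (suc _)))))) r xs _ K-rep = return-rep 0 K-rep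

eval-simulates : ∀ k m xs {Kₙ K} → StackRep Kₙ K →
                 StateRep (stepₙ (evalₙ (pair k m) (encodeList xs) Kₙ)) (step (eval (decode′ k m) xs K))
eval-simulates k m xs {Kₙ} K-rep =
  StateRep-≡ (trans (stepₙ-evalₙ (pair k m) (encodeList xs) Kₙ) (evalStep-pair k m (encodeList xs) Kₙ _)) (by-fuel k)
  where
  by-fuel : ∀ k → StateRep (ifz k (returnₙ 0 Kₙ) (evalTag (pred k) (unpair₁ m) (unpair₂ m) (encodeList xs) Kₙ
                                                          (evalₙ (pair k m) (encodeList xs) Kₙ)))
                             (step (eval (decode′ k m) xs _))
  by-fuel zero = return-rep 0 K-rep
  by-fuel (suc k) rewrite decode′-suc k m =
    evalTag-simulates k (unpair₁ m) (unpair₂ m) xs (subst (CodeRep (pair (suc k) m)) (decode′-suc k m) (code-rep (suc k) m)) K-rep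

last-argument : ∀ {fₙ f Kₙ K} → CodeRep fₙ f → ∀ acc v → StackRep Kₙ K →
                StateRep (evalₙ fₙ (reverseₙ (cons v (encodeList acc))) Kₙ) (eval f ((v ∷ acc) ʳ++ []) K)
last-argument f-rep acc v K-rep = StateRep-≡ (cong (λ l → evalₙ _ l _) (reverseₙ-correct (v ∷ acc))) (eval-rep f-rep _ K-rep)

returnC-simulates : ∀ {fₙ f Kₙ K} → CodeRep fₙ f → ∀ k m xs acc v → StackRep Kₙ K →
  StateRep (returnC fₙ (pair k m) (encodeList xs) (encodeList acc) v Kₙ) (step (return v (compose f (decodeList k m) xs acc ∷ K)))
returnC-simulates f-rep zero m xs acc v K-rep rewrite unpair₁-pair 0 m = last-argument f-rep acc v K-rep
returnC-simulates f-rep (suc k) zero xs acc v K-rep rewrite unpair₁-pair (suc k) 0 | unpair₂-pair (suc k) 0 =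
  last-argument f-rep acc v K-rep
returnC-simulates f-rep (suc k) (suc m) xs acc v K-rep
  rewrite unpair₁-pair (suc k) (suc m) | unpair₂-pair (suc k) (suc m) | decodeList-suc k m =
  eval-rep (code-rep k (unpair₁ m)) xs (∷-rep (compose-rep f-rep (codes-rep k (unpair₂ m)) xs (v ∷ acc)) K-rep)

returnR-simulates : ∀ {fₙ f gₙ g Kₙ K} → CodeRep fₙ f → CodeRep gₙ g → ∀ i n xs v → StackRep Kₙ K →
                    StateRep (returnR fₙ gₙ i n (encodeList xs) v Kₙ) (step (return v (recurse f g i n xs ∷ K)))
returnR-simulates f-rep g-rep i n xs v K-rep with ∣ i - n ∣
... | zero = return-rep v K-rep
... | suc _ = eval-rep g-rep (i ∷ v ∷ xs) (∷-rep (recurse-rep f-rep g-rep (suc i) n xs) K-rep)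

returnM-simulates : ∀ {fₙ f Kₙ K} → CodeRep fₙ f → ∀ i xs v → StackRep Kₙ K →
                    StateRep (returnM fₙ i (encodeList xs) v Kₙ) (step (return v (search f i xs ∷ K)))
returnM-simulates f-rep i xs zero K-rep = return-rep i K-rep
returnM-simulates f-rep i xs (suc v) K-rep = eval-rep f-rep (suc i ∷ xs) (∷-rep (search-rep f-rep (suc i) xs) K-rep)

return-simulates : ∀ {a F b K} v → FrameRep a F → StackRep b K →
                   StateRep (stepₙ (returnₙ v (cons a b))) (step (return v (F ∷ K)))
return-simulates {a} {b = b} v F-rep K-rep =
  StateRep-≡ (trans (stepₙ-returnₙ v (cons a b)) (returnStep-cons v a b (returnₙ v (cons a b)))) (by-frame F-rep)
  where
  by-frame : ∀ {a F} → FrameRep a F → StateRep (returnFrame (unpair₁ a) (unpair₂ a) v b) (step (return v (F ∷ _)))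
  by-frame (compose-rep {fₙ} f-rep (codes-rep k m) xs acc) =
    StateRep-≡ (returnFrame-composeₙ fₙ (pair k m) (encodeList xs) (encodeList acc) v b) (returnC-simulates f-rep k m xs acc v K-rep)
  by-frame (recurse-rep {fₙ} {gₙ = gₙ} f-rep g-rep i n xs) =
    StateRep-≡ (returnFrame-recurseₙ fₙ gₙ i n (encodeList xs) v b) (returnR-simulates f-rep g-rep i n xs v K-rep)
  by-frame (search-rep {fₙ} f-rep i xs) =
    StateRep-≡ (returnFrame-searchₙ fₙ i (encodeList xs) v b) (returnM-simulates f-rep i xs v K-rep)

stepₙ-simulates : ∀ {n s} → StateRep n s → StateRep (stepₙ n) (step s)
stepₙ-simulates (eval-rep (code-rep k m) xs K-rep) = eval-simulates k m xs K-rep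
stepₙ-simulates (return-rep v []-rep) = StateRep-≡ (stepₙ-returnₙ v 0) (return-rep v []-rep)
stepₙ-simulates (return-rep v (∷-rep F-rep K-rep)) = return-simulates v F-rep K-rep

iterate-simulates : ∀ {n s} → StateRep n s → ∀ t → StateRep (iterate stepₙ n t) (iterate step s t)
iterate-simulates s-rep zero = s-rep
iterate-simulates s-rep (suc t) = iterate-simulates (stepₙ-simulates s-rep) t

initialₙ : ℕ → ℕ → ℕ
initialₙ x z = evalₙ (pair x x) (cons z 0) 0

initial-rep : ∀ x z → StateRep (initialₙ x z) (eval (decode x) (z ∷ []) [])
initial-rep x z = eval-rep (code-rep x x) (z ∷ []) []-rep

-- suc v on a halted state with result v, 0 otherwise
outputₙ : ℕ → ℕ
outputₙ s = ifz (unpair₁ s) 0 (ifz (unpair₂ (unpair₂ s)) (suc (unpair₁ (unpair₂ s))) 0)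

outputₙ-sound : ∀ {n s v} → StateRep n s → outputₙ n ≡ suc v → s ≡ return v []
outputₙ-sound (eval-rep {cₙ} {Kₙ = Kₙ} _ xs _) out≡ rewrite unpair₁-pair 0 (pair cₙ (pair (encodeList xs) Kₙ)) with out≡
... | ()
outputₙ-sound (return-rep v []-rep) out≡
  rewrite unpair₁-pair 1 (pair v 0) | unpair₂-pair 1 (pair v 0) | unpair₂-pair v 0 | unpair₁-pair v 0 with out≡
... | refl = refl
outputₙ-sound (return-rep v (∷-rep {a} {b} _ _)) out≡
  rewrite unpair₁-pair 1 (pair v (cons a b)) | unpair₂-pair 1 (pair v (cons a b)) | unpair₂-pair v (cons a b) with out≡
... | ()

outputₙ-complete : ∀ {n v} → StateRep n (return v []) → outputₙ n ≡ suc v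
outputₙ-complete (return-rep v []-rep)
  rewrite unpair₁-pair 1 (pair v 0) | unpair₂-pair 1 (pair v 0) | unpair₂-pair v 0 | unpair₁-pair v 0 = refl

run : ℕ → ℕ → ℕ → ℕ
run x z t = outputₙ (iterate stepₙ (initialₙ x z) t)

run-sound : ∀ {x z t v} → run x z t ≡ suc v → φ x [ z ]⇓ v
run-sound {x} {z} {t} run≡ = machine-sound (t , outputₙ-sound (iterate-simulates (initial-rep x z) t) run≡)

run-complete : ∀ {x z v} → φ x [ z ]⇓ v → Σ ℕ λ t → run x z t ≡ suc v
run-complete {x} {z} φx⇓ with machine-complete φx⇓
... | t , halts = t , outputₙ-complete (subst (StateRep (iterate stepₙ (initialₙ x z) t)) halts
                                              (iterate-simulates (initial-rep x z) t))

runᶜ : Computable 3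
runᶜ = computable (outputᶜ ⟨ rec v2 (initialᶜ ⟨ v0 ∣ v1 ⟩) (stepₙᶜ ⟨ v1 ⟩) ⟩) (λ { (x ∷ z ∷ t ∷ []) → run x z t })
  λ { (x ∷ z ∷ t ∷ []) → cong outputₙ (recursion-iterate stepₙᶜ (x ∷ z ∷ t ∷ []) (initialₙ x z) t) }
  where
  initialᶜ : Computable 2
  initialᶜ = computable (evalᶜ ⟨ pairᶜ ⟨ v0 ∣ v0 ⟩ ∣ consᶜ ⟨ v1 ∣ zero ⟩ ∣ zero ⟩) (λ { (x ∷ z ∷ []) → initialₙ x z })
                        λ { (x ∷ z ∷ []) → refl }
  outputᶜ : Computable 1
  outputᶜ = computable
    (ifzᶜ ⟨ unpair₁ᶜ ⟨ v0 ⟩ ∣ zero ∣ ifzᶜ ⟨ unpair₂ᶜ ⟨ unpair₂ᶜ ⟨ v0 ⟩ ⟩ ∣ suc (unpair₁ᶜ ⟨ unpair₂ᶜ ⟨ v0 ⟩ ⟩) ∣ zero ⟩ ⟩)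
    (λ { (s ∷ []) → outputₙ s }) λ { (s ∷ []) → refl }

-- SI(F) is Π⁰₁

Π⁰₁-intro : ∀ {A : ℕ → Set} (g : Computable 2) →
            (∀ x → A x → ∀ n → fun g (x ∷ n ∷ []) ≡ 0) → (∀ x → (∀ n → fun g (x ∷ n ∷ []) ≡ 0) → A x) → Π⁰₁ A
Π⁰₁-intro g A⇒zero zero⇒A = code g , (λ x n → _ , correct g (x ∷ n ∷ []))
  , λ x → (λ a n → subst (code g [ x ∷ n ∷ [] ]⇓_) (A⇒zero x a n) (correct g (x ∷ n ∷ [])))
        , (λ zero⇓ → zero⇒A x (λ n → ⇓-deterministic (correct g (x ∷ n ∷ [])) (zero⇓ n)))

totalᶜ : (F : ℕ → ℕ) → TotalRecursive F → Computable 1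
totalᶜ F (e , φe⇓) = record { code = decode e ; fun = λ { (z ∷ []) → F z } ; correct = λ { (z ∷ []) → φe⇓ z } }

-- violation F x n ≠ 0 iff, for (z , t) = unpair n, φ_x(z) halts within t steps with a value above F z.
violation : (ℕ → ℕ) → ℕ → ℕ → ℕ
violation F x n = pred (run x (unpair₁ n) (unpair₂ n)) ∸ F (unpair₁ n)

SI⇒no-violation : ∀ {F x} → SI F x → ∀ n → violation F x n ≡ 0
SI⇒no-violation {F} {x} si n with run x (unpair₁ n) (unpair₂ n) in run≡
... | zero = 0∸n≡0 (F (unpair₁ n))
... | suc v = m≤n⇒m∸n≡0 (si (unpair₁ n) v (run-sound {x} {unpair₁ n} {unpair₂ n} run≡))

no-violation⇒SI : ∀ {F x} → (∀ n → violation F x n ≡ 0) → SI F x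
no-violation⇒SI {F} {x} none z v φx⇓ with run-complete φx⇓
... | t , run≡ = m∸n≡0⇒m≤n (begin
  v ∸ F z                   ≡⟨ cong (λ r → pred r ∸ F z) run≡ ⟨
  pred (run x z t) ∸ F z    ≡⟨ cong₂ (λ z t → pred (run x z t) ∸ F z) (unpair₁-pair z t) (unpair₂-pair z t) ⟨
  violation F x (pair z t)  ≡⟨ none (pair z t) ⟩
  0                         ∎)
  where open ≡-Reasoning

SI-Π⁰₁ : ∀ F → TotalRecursive F → Π⁰₁ (SI F)
SI-Π⁰₁ F F-rec = Π⁰₁-intro violationᶜ (λ _ → SI⇒no-violation) (λ _ → no-violation⇒SI)
  where
  violationᶜ : Computable 2
  violationᶜ = computable
    (∸ᶜ ⟨ predᶜ ⟨ runᶜ ⟨ v0 ∣ unpair₁ᶜ ⟨ v1 ⟩ ∣ unpair₂ᶜ ⟨ v1 ⟩ ⟩ ⟩ ∣ totalᶜ F F-rec ⟨ unpair₁ᶜ ⟨ v1 ⟩ ⟩ ⟩)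
    (λ { (x ∷ n ∷ []) → violation F x n }) λ { (x ∷ n ∷ []) → refl }

-- Every Π⁰₁ set reduces to SI(F)

isZero : ℕ → ℕ
isZero zero = 1
isZero (suc _) = 0

isZeroᶜ : Computable 1
isZeroᶜ = computable (rec v0 (lit 1) zero) (λ { (b ∷ []) → isZero b }) λ { (zero ∷ []) → refl ; (suc b ∷ []) → refl }

all-zero-or-first-nonzero : ∀ {V : ℕ → ℕ → Set} → (∀ n → Σ ℕ (V n)) → ∀ N →
  (∀ m → m < N → V m 0) ⊎ (Σ ℕ λ n → Σ ℕ λ k → V n (suc k) × (∀ m → m < n → V m 0))
all-zero-or-first-nonzero total zero = inj₁ λ m ()
all-zero-or-first-nonzero {V} total (suc N) with all-zero-or-first-nonzero total N
... | inj₂ first = inj₂ first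
... | inj₁ below with total N
...   | suc k , VN = inj₂ (N , k , VN , below)
...   | zero , VN = inj₁ below′
  where
  below′ : ∀ m → m < suc N → V m 0
  below′ m m<1+N with m≤n⇒m<n∨m≡n (≤-pred m<1+N)
  ... | inj₁ m<N = below m m<N
  ... | inj₂ refl = VN

module _ {N : ℕ} where
  ‵_ : Code → Term N
  ‵ c = lit ⌜ c ⌝

  ‵C : Term N → Term N → Term N
  ‵C f gs = pairᶜ ⟨ lit 3 ∣ pairᶜ ⟨ f ∣ gs ⟩ ⟩

  ‵M : Term N → Term N
  ‵M f = pairᶜ ⟨ lit 5 ∣ f ⟩

  ‵[] : Term N
  ‵[] = zero

  infixr 5 _‵∷_
  _‵∷_ : Term N → Term N → Term N
  g ‵∷ gs = suc (pairᶜ ⟨ g ∣ gs ⟩)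

⌜constant⌝ᶜ : Computable 1
⌜constant⌝ᶜ = computable (rec v0 (‵ Z) (‵C (‵ S) (v1 ‵∷ ‵[]))) (λ { (x ∷ []) → ⌜ constant x ⌝ })
                        λ { (x ∷ []) → quoted x }
  where
  quoted : ∀ {ρ} x → recursion (‵C (‵ S) (v1 ‵∷ ‵[])) ρ ⌜ Z ⌝ x ≡ ⌜ constant x ⌝
  quoted zero = refl
  quoted (suc x) = cong (λ t → pair 3 (pair ⌜ S ⌝ (suc (pair t 0)))) (quoted x)

module Reduction (F : ℕ → ℕ) (e : ℕ) (φe⇓ : ∀ z → φ e [ z ]⇓ F z)
                 (B : ℕ → Set) (c : Code) (total : ∀ x n → Σ ℕ λ b → c [ x ∷ n ∷ [] ]⇓ b)
                 (B⇔zero : ∀ x → (B x → ∀ n → c [ x ∷ n ∷ [] ]⇓ 0) × ((∀ n → c [ x ∷ n ∷ [] ]⇓ 0) → B x)) where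

  -- On (n , z): 0 iff c (x , n) ≠ 0, so that μ searches for a counterexample to B x.
  test : ℕ → Code
  test x = C (code isZeroᶜ) (C c (constant x ∷ P 0 ∷ []) ∷ [])

  -- z ↦ (μ n. c (x , n) ≠ 0) ; F z + 1
  reduct : ℕ → Code
  reduct x = C (P 1) (M (test x) ∷ C S (decode e ∷ []) ∷ [])

  test-correct : ∀ {x n b} z → c [ x ∷ n ∷ [] ]⇓ b → test x [ n ∷ z ∷ [] ]⇓ isZero b
  test-correct {x} {n} {b} z c⇓ =
    ⇓C (∷⇓ (⇓C (∷⇓ (constant-correct x _) (∷⇓ ⇓P []⇓)) c⇓) []⇓) (correct isZeroᶜ (b ∷ []))

  reduct-halts⇒search-halts : ∀ {x z v} → reduct x [ z ∷ [] ]⇓ v → Σ ℕ λ n → M (test x) [ z ∷ [] ]⇓ n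
  reduct-halts⇒search-halts (⇓C (∷⇓ search⇓ _) _) = _ , search⇓

  search-halts⇒reduct-exceeds : ∀ {x z n} → M (test x) [ z ∷ [] ]⇓ n → reduct x [ z ∷ [] ]⇓ suc (F z)
  search-halts⇒reduct-exceeds {z = z} search⇓ = ⇓C (∷⇓ search⇓ (∷⇓ (⇓C (∷⇓ (φe⇓ z) []⇓) ⇓S) []⇓)) ⇓P

  B⇒SI : ∀ x → B x → SI F ⌜ reduct x ⌝
  B⇒SI x Bx z v φ⇓ with reduct-halts⇒search-halts (subst (_[ z ∷ [] ]⇓ v) (decode-⌜⌝ (reduct x)) φ⇓)
  ... | n , ⇓M test⇓0 _ with ⇓-deterministic test⇓0 (test-correct z (proj₁ (B⇔zero x) Bx n))
  ... | ()

  SI⇒B : ∀ x → SI F ⌜ reduct x ⌝ → B x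
  SI⇒B x si = proj₂ (B⇔zero x) λ n → [ (λ below → below n ≤-refl) , (λ first → ⊥-elim (exceeds first)) ]′
                                        (all-zero-or-first-nonzero (total x) (suc n))
    where
    exceeds : (Σ ℕ λ n → Σ ℕ λ k → c [ x ∷ n ∷ [] ]⇓ suc k × (∀ m → m < n → c [ x ∷ m ∷ [] ]⇓ 0)) → ⊥
    exceeds (n , k , c⇓ , below) = n≮n (F 0) (si 0 (suc (F 0)) reduct⇓)
      where
      reduct⇓ : φ ⌜ reduct x ⌝ [ 0 ]⇓ suc (F 0)
      reduct⇓ = subst (_[ 0 ∷ [] ]⇓ suc (F 0)) (sym (decode-⌜⌝ (reduct x))) (search-halts⇒reduct-exceeds
                  (⇓M (test-correct 0 c⇓) (λ m m<n → 0 , test-correct 0 (below m m<n))))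

  ⌜reduct⌝ᶜ : Computable 1
  ⌜reduct⌝ᶜ = computable
    (‵C (‵ P 1) (‵M (‵C (‵ code isZeroᶜ) (‵C (‵ c) (⌜constant⌝ᶜ ⟨ v0 ⟩ ‵∷ ‵ P 0 ‵∷ ‵[]) ‵∷ ‵[]))
                 ‵∷ ‵ C S (decode e ∷ []) ‵∷ ‵[]))
    (λ { (x ∷ []) → ⌜ reduct x ⌝ }) λ { (x ∷ []) → refl }

  B≤ₘSI : B ≤ₘ SI F
  B≤ₘSI = ⌜ code ⌜reduct⌝ᶜ ⌝ , (λ x → _ , index⇓ x)
        , λ x y index⇓y → B⇔SI x y (⇓-deterministic index⇓y (index⇓ x))
    where
    index⇓ : ∀ x → φ ⌜ code ⌜reduct⌝ᶜ ⌝ [ x ]⇓ ⌜ reduct x ⌝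
    index⇓ x = subst (_[ x ∷ [] ]⇓ ⌜ reduct x ⌝) (sym (decode-⌜⌝ (code ⌜reduct⌝ᶜ))) (correct ⌜reduct⌝ᶜ (x ∷ []))
    B⇔SI : ∀ x y → y ≡ ⌜ reduct x ⌝ → (B x → SI F y) × (SI F y → B x)
    B⇔SI x _ refl = B⇒SI x , SI⇒B x

theorem4 : (F : ℕ → ℕ) → TotalRecursive F → Π⁰₁-complete (SI F)
theorem4 F F-rec@(e , φe⇓) = SI-Π⁰₁ F F-rec , λ { B (c , total , B⇔zero) → Reduction.B≤ₘSI F e φe⇓ B c total B⇔zero }
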